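{- Consider an instance of 2NC-TAP, let $\lambda=\max\{|E(T(\ell))| : \ell\in L(G)\}$, and let $\hat F$ be the set of links returned by the greedy algorithm described in the context. Then \[ \mathit{cost}(\hat F)\le H(\lambda-1)\cdot \mathrm{opt}(P), \] where $\mathrm{opt}(P)$ is the optimal value of the linear program \[ (P)\quad \min \sum_{\ell\in L(G)} \mathit{cost}(\ell)\,x_\ell \quad\text{s.t.}\quad \sum_{\ell\in L(G):\ \ell \text{ crosses } \mathcal{P}} x_\ell \ge |\mathcal{P}|-1\ \ \forall u\in\mathrm{nonleaf}(T),\ \forall\mathcal{P}\in\Pi(u);\qquad x_\ell\ge 0\ \ \forall \ell\in L(G). \]
   Context: 2NC-TAP instance: a simple undirected graph $G=(V,E)$ that is 2-node connected (at least 3 nodes, connected, and remains connected after deleting any one node), nonnegative costs $\mathit{cost}\in\mathbb{R}_+^E$, and a spanning tree $T$ of $G$ all of whose edges have cost $0$. The edges of $E(G)\setminus E(T)$ are called links; $L(G)$ is the set of links; $\mathit{cost}(F)=\sum_{\ell\in F}\mathit{cost}(\ell)$. For a link $\ell$, $T(\ell)$ is the path in $T$ between the end nodes of $\ell$. $H(k)=1+\frac12+\dots+\frac1k$ is the $k$-th harmonic number. $\mathrm{nonleaf}(T)$ is the set of non-leaf nodes of $T$. For $u\in\mathrm{nonleaf}(T)$, $\pi(\mathrm{comps}(T-u))$ is the partition of $V\setminus\{u\}$ into the node sets of the connected components of $T-u$, and $\Pi(u)$ is the set of partitions of $V\setminus\{u\}$ of which $\pi(\mathrm{comps}(T-u))$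 is a refinement; $|\mathcal{P}|$ is the number of parts of $\mathcal{P}$. A link $\ell$ crosses a partition $\mathcal{P}$ of $V\setminus\{u\}$ if both end nodes of $\ell$ lie in $V\setminus\{u\}$ and in different parts of $\mathcal{P}$. Greedy algorithm: start with $F=\emptyset$. In iteration $i=1,2,\dots$, let $F^i$ be the set of links picked so far; for each $u\in\mathrm{nonleaf}(T)$ let $\mathcal{P}^i_u\in\Pi(u)$ be the partition of $V\setminus\{u\}$ into node sets of the connected components of $(T\cup F^i)-u$; for each link $\ell$ let $\mathrm{inc}^i(\ell)=\{\mathcal{P}^i_u : u\in\mathrm{nonleaf}(T),\ \ell \text{ crosses } \mathcal{P}^i_u\}$. The iteration picks a link $\ell^*$ with $\mathrm{inc}^i(\ell^*)\ne\emptyset$ minimizing $\mathit{cost}(\ell^*)/|\mathrm{inc}^i(\ell^*)|$ (ties broken arbitrarily) and sets $F^{i+1}=F^i\cup\{\ell^*\}$. The algorithm stops when $T\cup F$ is a 2-node connected spanning subgraph of $G$, and returns $\hat F=F$.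
   Formalization: The edge costs and the variables $x_\ell$ of the linear program (P) take rational values instead of real ones. -}

module Defs where

open import Data.Nat as ℕ using (ℕ; zero; suc; _∸_)
open import Data.Fin using (Fin; toℕ; _≟_)
open import Data.Bool using (Bool; true; false; _∧_; not; if_then_else_)
open import Data.List using (List; []; _∷_; length; take; lookup; foldr; allFin)
open import Data.List.Relation.Unary.All using (All)
open import Data.List.Relation.Unary.Unique.Propositional using (Unique)
open import Data.List.Membership.Propositional using (_∈_)
open import Data.Product using (Σ; ∃; _×_; _,_)
open import Data.Sum using (_⊎_)
open import Data.Unit using (⊤)
open import Data.Integer using (+_)
open import Relation.Binary.PropositionalEquality using (_≡_; _≢_)
open import Relation.Nullary using (¬_)
open import Relation.Nullary.Decidable using (⌊_⌋)
open import Data.Rational using (ℚ; 0ℚ; 1ℚ; _+_; _*_; _-_; _≤_; _/_)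

BRel : ℕ → Set
BRel n = Fin n → Fin n → Bool

Adj : ∀ {n} → BRel n → Fin n → Fin n → Set
Adj R a b = R a b ≡ true

data Walk {n} (R : Fin n → Fin n → Set) : Fin n → Fin n → List (Fin n) → Set where
  here : ∀ a → Walk R a a (a ∷ [])
  step : ∀ {a b c vs} → R a b → Walk R b c vs → Walk R a c (a ∷ vs)

Reach : ∀ {n} → (Fin n → Fin n → Set) → (Fin n → Set) → Fin n → Fin n → Set
Reach R S a b = ∃ λ vs → Walk R a b vs × All S vs

ConnectedOn : ∀ {n} → (Fin n → Fin n → Set) → (Fin n → Set) → Set
ConnectedOn R S = ∀ a b → S a → S b → Reach R S a b

Connected : ∀ {n} → (Fin n → Fin n → Set) → Set
Connected R = ConnectedOn R (λ _ → ⊤)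

TwoNodeConnected : (n : ℕ) → (Fin n → Fin n → Set) → Set
TwoNodeConnected n R =
  3 ℕ.≤ n × Connected R × (∀ u → ConnectedOn R (λ v → v ≢ u))

Card : ∀ {n} → (Fin n → Set) → ℕ → Set
Card {n} P k = Σ (List (Fin n)) λ us →
  Unique us × (∀ v → v ∈ us → P v) × (∀ v → P v → v ∈ us) × length us ≡ k

SimpleGraph : ∀ {n} → BRel n → Set
SimpleGraph E = (∀ i j → E i j ≡ E j i) × (∀ i → E i i ≡ false)

HasCycle : ∀ {n} → (Fin n → Fin n → Set) → Set
HasCycle {n} R = Σ (List (Fin n)) λ vs → ∃ λ a → ∃ λ b →
  3 ℕ.≤ length vs × Unique vs × Walk R a b vs × R b a

SpanningTree : ∀ {n} → BRel n → BRel n → Set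
SpanningTree E Tr = (∀ i j → Tr i j ≡ true → E i j ≡ true) × (∀ i j → Tr i j ≡ Tr j i)
  × Connected (Adj Tr) × ¬ HasCycle (Adj Tr)

-- links (edges of G not in T), each represented once, as (i , j) with i < j
isLink : ∀ {n} → BRel n → BRel n → Fin n → Fin n → Bool
isLink E Tr i j = E i j ∧ not (Tr i j) ∧ (toℕ i ℕ.<ᵇ toℕ j)

Link : ℕ → Set
Link n = Fin n × Fin n

sumFin : ∀ {n} → (Fin n → ℚ) → ℚ
sumFin {n} f = foldr (λ i acc → f i + acc) 0ℚ (allFin n)

linkSum : ∀ {n} → BRel n → BRel n → (Fin n → Fin n → ℚ) → ℚ
linkSum E Tr f = sumFin λ i → sumFin λ j → if isLink E Tr i j then f i j else 0ℚ

ℕtoℚ : ℕ → ℚ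
ℕtoℚ k = + k / 1

H : ℕ → ℚ
H zero = 0ℚ
H (suc k) = H k + (+ 1 / suc k)

NonLeaf : ∀ {n} → BRel n → Fin n → Set
NonLeaf Tr u = ¬ Card (λ j → Tr u j ≡ true) 1

TF : ∀ {n} → BRel n → List (Link n) → Fin n → Fin n → Set
TF Tr Fs a b = Tr a b ≡ true ⊎ (a , b) ∈ Fs ⊎ (b , a) ∈ Fs

-- P_u(F): partition of V∖{u} into components of (T ∪ F) − u.  ℓ = (a , b) crosses it:
CrossesComps : ∀ {n} → BRel n → List (Link n) → Fin n → Link n → Set
CrossesComps Tr Fs u (a , b) = a ≢ u × b ≢ u × ¬ Reach (TF Tr Fs) (λ v → v ≢ u) a b

-- u indexes a member P_u(F) of inc(ℓ)  (distinct u give distinct partitions, as their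
-- ground sets V∖{u} differ)
Inc : ∀ {n} → BRel n → List (Link n) → Link n → Fin n → Set
Inc Tr Fs ℓ u = NonLeaf Tr u × CrossesComps Tr Fs u ℓ

lcost : ∀ {n} → (Fin n → Fin n → ℚ) → Link n → ℚ
lcost c (a , b) = c a b

-- ℓ is a valid greedy choice given the current link set Fs:
-- inc(ℓ) ≠ ∅ and cost(ℓ)/|inc(ℓ)| ≤ cost(ℓ')/|inc(ℓ')| for every link ℓ' with inc(ℓ') ≠ ∅
GreedyChoice : ∀ {n} → BRel n → BRel n → (Fin n → Fin n → ℚ) → List (Link n) → Link n → Set
GreedyChoice E Tr c Fs (a , b) =
  isLink E Tr a b ≡ true ×
  (∃ λ k → Card (Inc Tr Fs (a , b)) k × 1 ℕ.≤ k ×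
    (∀ a' b' k' → isLink E Tr a' b' ≡ true → Card (Inc Tr Fs (a' , b')) k' → 1 ℕ.≤ k' →
       c a b * ℕtoℚ k' ≤ c a' b' * ℕtoℚ k))

-- Fs = ℓ₁ ∷ … ∷ ℓₘ is a complete run of the greedy algorithm (arbitrary tie breaking):
-- before each iteration T ∪ F^i is not 2NC and ℓᵢ is a greedy choice w.r.t. F^i;
-- at the end T ∪ F is 2NC.
GreedyRun : ∀ {n} → BRel n → BRel n → (Fin n → Fin n → ℚ) → List (Link n) → Set
GreedyRun {n} E Tr c Fs =
  (∀ (i : Fin (length Fs)) →
      ¬ TwoNodeConnected n (TF Tr (take (toℕ i) Fs)) ×
      GreedyChoice E Tr c (take (toℕ i) Fs) (lookup Fs i))
  × TwoNodeConnected n (TF Tr Fs)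

costList : ∀ {n} → (Fin n → Fin n → ℚ) → List (Link n) → ℚ
costList c Fs = foldr (λ ℓ acc → lcost c ℓ + acc) 0ℚ Fs

-- |E(T(a,b))| = k : the path in T from a to b has k edges
TreePathLength : ∀ {n} → BRel n → Fin n → Fin n → ℕ → Set
TreePathLength Tr a b k =
  ∃ λ vs → Walk (Adj Tr) a b vs × Unique vs × length vs ≡ suc k

IsMaxTreePathLength : ∀ {n} → BRel n → BRel n → ℕ → Set
IsMaxTreePathLength E Tr lam =
  (∀ a b k → isLink E Tr a b ≡ true → TreePathLength Tr a b k → k ℕ.≤ lam) ×
  (∃ λ a → ∃ λ b → isLink E Tr a b ≡ true × TreePathLength Tr a b lam)

-- partitions of V∖{u}: labelling p (parts = classes of equal labels among v ≢ u)
-- P ∈ Π(u): π(comps(T − u)) refines P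
InPi : ∀ {n} → BRel n → Fin n → (Fin n → Fin n) → Set
InPi Tr u p = ∀ v w → v ≢ u → w ≢ u → Reach (Adj Tr) (λ z → z ≢ u) v w → p v ≡ p w

NumParts : ∀ {n} → Fin n → (Fin n → Fin n) → ℕ → Set
NumParts u p k = Card (λ c → ∃ λ v → v ≢ u × p v ≡ c) k

crossesP : ∀ {n} → Fin n → (Fin n → Fin n) → Fin n → Fin n → Bool
crossesP u p i j = not ⌊ i ≟ u ⌋ ∧ not ⌊ j ≟ u ⌋ ∧ not ⌊ p i ≟ p j ⌋

FeasibleP : ∀ {n} → BRel n → BRel n → (Fin n → Fin n → ℚ) → Set
FeasibleP E Tr x =
  (∀ i j → isLink E Tr i j ≡ true → 0ℚ ≤ x i j) ×
  (∀ u → NonLeaf Tr u → ∀ p → InPi Tr u p → ∀ k → NumParts u p k →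
     ℕtoℚ k - 1ℚ ≤ linkSum E Tr (λ i j → if crossesP u p i j then x i j else 0ℚ))

{-# OPTIONS --safe #-}

-- Write k_j = |inc^j(ℓ_j)| and θ_j = cost(ℓ_j)/k_j for the price per partition paid in
-- iteration j.  Greediness gives θ_j |inc^j(ℓ)| ≤ cost(ℓ) for every link ℓ, and since
-- inc^{j+1}(ℓ) ⊆ inc^j(ℓ) the prices θ_j are nondecreasing.  Abel summation turns
-- cost(F̂) = Σ_j θ_j k_j into Σ_j (θ_j − θ_{j−1}) K_j with K_j = Σ_{s ≥ j} k_s.
--
-- An iteration s ≥ j whose link crosses P^s_u joins two parts of P^s_u, and these
-- partitions only get coarser, so at most |P^j_u| − 1 ≤ Σ_{ℓ crosses P^j_u} x_ℓ such
-- iterations happen at u; summed over u this gives K_j ≤ Σ_ℓ x_ℓ |inc^j(ℓ)|.  For a fixed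
-- link ℓ the numbers |inc^j(ℓ)| decrease from at most λ − 1 (the inner nodes of T(ℓ)) to
-- 0, and θ_j ≤ cost(ℓ)/i while |inc^j(ℓ)| ≥ i, so Σ_j (θ_j − θ_{j−1}) |inc^j(ℓ)| is at
-- most cost(ℓ) H(λ − 1).  Exchanging the order of summation gives the bound.

module Submission where

open import Defs
open import Data.Nat using (ℕ; _∸_)
open import Data.Fin using (Fin)
open import Data.List using (List)
open import Data.Bool using (true)
open import Relation.Binary.PropositionalEquality using (_≡_)
open import Data.Rational using (ℚ; 0ℚ; _*_; _≤_)

import Data.Nat as ℕ
import Data.Nat.Properties as ℕ
open Data.Nat using (zero; suc; z≤n; s≤s)
open import Data.Fin using (zero; suc; _≟_; fromℕ<; toℕ) renaming (_<_ to _<ᶠ_)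
import Data.Fin.Properties as Fin
open import Data.Bool using (Bool; false; if_then_else_; _∧_; not)
open import Data.Bool.Properties using (∧-conicalˡ)
open import Data.List using ([]; _∷_; length; take; lookup; allFin; filter; foldr)
import Data.List.Properties as List
open import Data.List.Relation.Unary.All as All using (All; []; _∷_)
open import Data.List.Relation.Unary.All.Properties using (¬Any⇒All¬)
open import Data.List.Relation.Unary.Any using (here; there; index)
open import Data.List.Relation.Unary.AllPairs using ([]; _∷_)
open import Data.List.Relation.Unary.Unique.Propositional using (Unique)
open import Data.List.Relation.Unary.Unique.Propositional.Properties using (allFin⁺; filter⁺)
open import Data.List.Membership.Propositional using (_∈_; _─_)
open import Data.List.Membership.Propositional.Properties using (∈-allFin; ∈-filter⁺; ∈-filter⁻)
open import Data.Maybe using (Maybe; just; nothing; fromMaybe)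
import Data.Maybe as Maybe
import Data.Maybe.Properties as Maybe
open import Data.Product using (∃; _×_; _,_; proj₁; proj₂)
open import Data.Sum using (_⊎_; inj₁; inj₂)
open import Data.Unit using (tt)
open import Data.Empty using (⊥; ⊥-elim)
open import Function using (_∘_; mk⇔)
open import Relation.Binary.PropositionalEquality
  using (_≢_; refl; sym; trans; cong; cong₂; subst; subst₂; module ≡-Reasoning)
open import Relation.Nullary using (¬_; Dec; yes; no; does)
open import Relation.Nullary.Decidable using (decidable-stable; ¬?; _×-dec_; does-⇔; isYes≗does)
open import Relation.Nullary.Decidable.Core using (¬¬-excluded-middle)
open import Relation.Unary using (Decidable)
open import Data.Integer using (+_)
import Data.Integer as ℤ
import Data.Integer.Properties as ℤ
open import Data.Nat.Coprimality using (1-coprimeTo) renaming (sym to coprime-sym)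
open import Data.Rational using (_+_; _-_; -_; 1ℚ; mkℚ; _/_; nonNegative)
import Data.Rational.Properties as ℚ
open import Data.Rational.Solver using (module +-*-Solver)
open +-*-Solver using (solve; _:+_; _:*_; _:-_; _:=_; con)

module _ {A : Set} where

  ∈-─ : ∀ {x v : A} {ys} (x∈ys : x ∈ ys) → v ∈ ys → v ≢ x → v ∈ ys ─ x∈ys
  ∈-─ (here refl)  (here refl)  v≢x = ⊥-elim (v≢x refl)
  ∈-─ (here _)     (there v∈ys) _   = v∈ys
  ∈-─ (there _)    (here refl)  _   = here refl
  ∈-─ (there x∈ys) (there v∈ys) v≢x = there (∈-─ x∈ys v∈ys v≢x)

  Unique-⊆⇒length-≤ : ∀ {xs ys : List A} → Unique xs → (∀ {v} → v ∈ xs → v ∈ ys) →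
                      length xs ℕ.≤ length ys
  Unique-⊆⇒length-≤ {[]}     _             _   = z≤n
  Unique-⊆⇒length-≤ {x ∷ xs} {ys} (x∉xs ∷ xs!) xs⊆ys =
    subst (suc (length xs) ℕ.≤_) (sym (List.length-removeAt′ ys (index x∈ys)))
      (s≤s (Unique-⊆⇒length-≤ xs! λ v∈xs →
        ∈-─ x∈ys (xs⊆ys (there v∈xs)) (All.lookup x∉xs v∈xs ∘ sym)))
    where
    x∈ys : x ∈ ys
    x∈ys = xs⊆ys (here refl)

module _ {n : ℕ} where

  count : {P : Fin n → Set} → Decidable P → ℕ
  count P? = length (filter P? (allFin n))

  Card-count : {P : Fin n → Set} (P? : Decidable P) → Card P (count P?)
  Card-count P? = filter P? (allFin n) , filter⁺ P? (allFin⁺ n) ,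
    (λ v v∈ → proj₂ (∈-filter⁻ P? {xs = allFin n} v∈)) ,
    (λ v Pv → ∈-filter⁺ P? (∈-allFin v) Pv) , refl

  Card-∅ : Card {n} (λ _ → ⊥) 0
  Card-∅ = [] , [] , (λ _ ()) , (λ _ ()) , refl

  Card-insert : ∀ {P : Fin n → Set} {k r} → Card P k → ¬ P r →
                Card (λ v → v ≡ r ⊎ P v) (suc k)
  Card-insert {P} {r = r} (us , us! , us⊆P , P⊆us , refl) ¬Pr =
    r ∷ us , r∉us ∷ us! , r∷us⊆ , ⊆r∷us , refl
    where
    r∉us : All (r ≢_) us
    r∉us = All.tabulate λ {v} v∈us r≡v → ¬Pr (subst P (sym r≡v) (us⊆P v v∈us))
    r∷us⊆ : ∀ v → v ∈ r ∷ us → v ≡ r ⊎ P v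
    r∷us⊆ v (here v≡r)   = inj₁ v≡r
    r∷us⊆ v (there v∈us) = inj₂ (us⊆P v v∈us)
    ⊆r∷us : ∀ v → v ≡ r ⊎ P v → v ∈ r ∷ us
    ⊆r∷us v (inj₁ v≡r) = here v≡r
    ⊆r∷us v (inj₂ Pv)  = there (P⊆us v Pv)

  Card-≤ : ∀ {P Q : Fin n → Set} {k l} → Card P k → Card Q l →
           (∀ {v} → P v → Q v) → k ℕ.≤ l
  Card-≤ (us , us! , us⊆P , _ , refl) (vs , _ , _ , Q⊆vs , refl) P⊆Q =
    Unique-⊆⇒length-≤ us! λ {v} v∈us → Q⊆vs v (P⊆Q (us⊆P v v∈us))

  Card-< : ∀ {P Q : Fin n → Set} {k l} → Card P k → Card Q l →
           (∀ {v} → P v → Q v) → ∀ {r} → Q r → ¬ P r → k ℕ.< l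
  Card-< {P} {Q} cardP cardQ P⊆Q {r} Qr ¬Pr = Card-≤ (Card-insert cardP ¬Pr) cardQ r∪P⊆Q
    where
    r∪P⊆Q : ∀ {v} → v ≡ r ⊎ P v → Q v
    r∪P⊆Q (inj₁ refl) = Qr
    r∪P⊆Q (inj₂ Pv)   = P⊆Q Pv

  Card-unique : ∀ {P : Fin n → Set} {k l} → Card P k → Card P l → k ≡ l
  Card-unique cₖ cₗ = ℕ.≤-antisym (Card-≤ cₖ cₗ λ p → p) (Card-≤ cₗ cₖ λ p → p)

least : ∀ {n} {P : Fin n → Set} → Decidable P → Maybe (Fin n)
least {zero}  P? = nothing
least {suc n} P? with P? zero
... | yes _ = just zero
... | no  _ = Maybe.map suc (least (P? ∘ suc))

least-sound : ∀ {n} {P : Fin n → Set} (P? : Decidable P) {i} → least P? ≡ just i → P i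
least-sound {suc n} P? eq with P? zero
least-sound {suc n} P? refl | yes P₀ = P₀
... | no _ with least (P? ∘ suc) in eq′
least-sound {suc n} P? refl | no _ | just _ = least-sound (P? ∘ suc) eq′

least-minimal : ∀ {n} {P : Fin n → Set} (P? : Decidable P) {i j} →
                least P? ≡ just i → j <ᶠ i → ¬ P j
least-minimal {suc n} P? eq j<i with P? zero
least-minimal {suc n} P? refl () | yes _
... | no ¬P₀ with least (P? ∘ suc) in eq′
least-minimal {suc n} P? {j = zero}  refl _         | no ¬P₀ | just _ = ¬P₀
least-minimal {suc n} P? {j = suc j} refl (s≤s j<i) | no _   | just _ =
  least-minimal (P? ∘ suc) eq′ j<i

least-complete : ∀ {n} {P : Fin n → Set} (P? : Decidable P) {i} → P i →
                 ∃ λ j → least P? ≡ just j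
least-complete {suc n} P? Pi with P? zero
... | yes _ = zero , refl
least-complete {suc n} P? {zero}  Pi | no ¬P₀ = ⊥-elim (¬P₀ Pi)
least-complete {suc n} P? {suc i} Pi | no _ =
  let j , eq = least-complete (P? ∘ suc) Pi in suc j , cong (Maybe.map suc) eq

least-unique : ∀ {n} {P : Fin n → Set} (P? : Decidable P) {i} →
               P i → (∀ {j} → j <ᶠ i → ¬ P j) → least P? ≡ just i
least-unique {suc n} P? {zero} P₀ _ with P? zero
... | yes _  = refl
... | no ¬P₀ = ⊥-elim (¬P₀ P₀)
least-unique {suc n} P? {suc i} Pi below with P? zero
... | yes P₀ = ⊥-elim (below {zero} (s≤s z≤n) P₀)
... | no _   = cong (Maybe.map suc) (least-unique (P? ∘ suc) Pi λ j<i → below (s≤s j<i))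

least-cong : ∀ {n} {P Q : Fin n → Set} (P? : Decidable P) (Q? : Decidable Q) →
             (∀ {i} → P i → Q i) → (∀ {i} → Q i → P i) → least P? ≡ least Q?
least-cong {zero}  P? Q? _ _ = refl
least-cong {suc n} P? Q? P⇒Q Q⇒P with P? zero | Q? zero
... | yes _  | yes _  = refl
... | yes P₀ | no ¬Q₀ = ⊥-elim (¬Q₀ (P⇒Q P₀))
... | no ¬P₀ | yes Q₀ = ⊥-elim (¬P₀ (Q⇒P Q₀))
... | no _   | no _   = cong (Maybe.map suc) (least-cong (P? ∘ suc) (Q? ∘ suc) P⇒Q Q⇒P)

module _ {n : ℕ} {R : Fin n → Fin n → Set} where

  open import Data.List.Membership.DecPropositional (_≟_ {n}) using (_∈?_)

  walk-head∈ : ∀ {a b vs} → Walk R a b vs → a ∈ vs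
  walk-head∈ (here _)   = here refl
  walk-head∈ (step _ _) = here refl

  walk-last∈ : ∀ {a b vs} → Walk R a b vs → b ∈ vs
  walk-last∈ (here _)   = here refl
  walk-last∈ (step _ w) = there (walk-last∈ w)

  walk-length : ∀ {a b vs} → Walk R a b vs → length vs ≡ suc (ℕ.pred (length vs))
  walk-length (here _)   = refl
  walk-length (step _ _) = refl

  walk-from : ∀ {x b ws a} → Walk R x b ws → Unique ws → a ∈ ws →
              ∃ λ vs → Walk R a b vs × Unique vs
  walk-from w@(here _)   ws!       (here refl)  = _ , w , ws!
  walk-from w@(step _ _) ws!       (here refl)  = _ , w , ws!
  walk-from (step _ w)   (_ ∷ ws!) (there a∈ws) = walk-from w ws! a∈ws

  walk⇒path : ∀ {a b vs} → Walk R a b vs → ∃ λ ws → Walk R a b ws × Unique ws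
  walk⇒path (here a) = _ , here a , [] ∷ []
  walk⇒path {a} (step r w) with walk⇒path w
  ... | ws , w′ , ws! with a ∈? ws
  ...   | yes a∈ws = walk-from w′ ws! a∈ws
  ...   | no  a∉ws = a ∷ ws , step r w′ , ¬Any⇒All¬ ws a∉ws ∷ ws!

  module _ {S : Fin n → Set} where

    reach-head : ∀ {a b} → Reach R S a b → S a
    reach-head (_ , w , Svs) = All.lookup Svs (walk-head∈ w)

    reach-last : ∀ {a b} → Reach R S a b → S b
    reach-last (_ , w , Svs) = All.lookup Svs (walk-last∈ w)

    reach-refl : ∀ {a} → S a → Reach R S a a
    reach-refl {a} Sa = _ , here a , Sa ∷ []

    reach-edge : ∀ {a b} → S a → S b → R a b → Reach R S a b
    reach-edge {b = b} Sa Sb r = _ , step r (here b) , Sa ∷ Sb ∷ []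

    reach-trans : ∀ {a b c} → Reach R S a b → Reach R S b c → Reach R S a c
    reach-trans (_ , here _ , _) b~c = b~c
    reach-trans (_ , step r w , Sa ∷ Svs) b~c with reach-trans (_ , w , Svs) b~c
    ... | vs , w′ , Svs′ = _ , step r w′ , Sa ∷ Svs′

    reach-sym : (∀ {a b} → R a b → R b a) → ∀ {a b} → Reach R S a b → Reach R S b a
    reach-sym R-sym (_ , here a , Svs) = _ , here a , Svs
    reach-sym R-sym (_ , step r w , Sa ∷ Svs) =
      reach-trans (reach-sym R-sym (_ , w , Svs)) (reach-edge (reach-head (_ , w , Svs)) Sa (R-sym r))

    reach-mono : ∀ {R′ : Fin n → Fin n → Set} → (∀ {a b} → R a b → R′ a b) →
                 ∀ {a b} → Reach R S a b → Reach R′ S a b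
    reach-mono {R′} R⊆R′ (vs , w , Svs) = vs , map-walk w , Svs
      where
      map-walk : ∀ {a b vs} → Walk R a b vs → Walk R′ a b vs
      map-walk (here a)   = here a
      map-walk (step r w) = step (R⊆R′ r) (map-walk w)

-- Rational arithmetic and harmonic numbers

p≤p+q : ∀ p {q} → 0ℚ ≤ q → p ≤ p + q
p≤p+q p 0≤q = subst (_≤ p + _) (ℚ.+-identityʳ p) (ℚ.+-monoʳ-≤ p 0≤q)

*-monoˡ-≤ : ∀ {r p q} → 0ℚ ≤ r → p ≤ q → r * p ≤ r * q
*-monoˡ-≤ {r} 0≤r = ℚ.*-monoˡ-≤-nonNeg r {{nonNegative 0≤r}}

*-monoʳ-≤ : ∀ {r p q} → 0ℚ ≤ r → p ≤ q → p * r ≤ q * r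
*-monoʳ-≤ {r} 0≤r = ℚ.*-monoʳ-≤-nonNeg r {{nonNegative 0≤r}}

ℕtoℚ≡mkℚ : ∀ k → ℕtoℚ k ≡ mkℚ (+ k) 0 (coprime-sym (1-coprimeTo k))
ℕtoℚ≡mkℚ k = ℚ.↥p/↧p≡p (mkℚ (+ k) 0 (coprime-sym (1-coprimeTo k)))

ℕtoℚ-nonneg : ∀ k → 0ℚ ≤ ℕtoℚ k
ℕtoℚ-nonneg k = subst (0ℚ ≤_) (sym (ℕtoℚ≡mkℚ k)) (ℚ.nonNegative⁻¹ _)

ℕtoℚ-suc : ∀ k → ℕtoℚ (suc k) ≡ 1ℚ + ℕtoℚ k
ℕtoℚ-suc k = trans (cong (λ z → (+ 1 ℤ.+ z) / 1) (sym (ℤ.*-identityʳ (+ k))))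
                   (sym (cong₂ _+_ (ℕtoℚ≡mkℚ 1) (ℕtoℚ≡mkℚ k)))

ℕtoℚ-+ : ∀ a b → ℕtoℚ (a ℕ.+ b) ≡ ℕtoℚ a + ℕtoℚ b
ℕtoℚ-+ zero    b = sym (ℚ.+-identityˡ (ℕtoℚ b))
ℕtoℚ-+ (suc a) b = begin
  ℕtoℚ (suc (a ℕ.+ b))        ≡⟨ ℕtoℚ-suc (a ℕ.+ b) ⟩
  1ℚ + ℕtoℚ (a ℕ.+ b)         ≡⟨ cong (_+_ 1ℚ) (ℕtoℚ-+ a b) ⟩
  1ℚ + (ℕtoℚ a + ℕtoℚ b)      ≡⟨ sym (ℚ.+-assoc 1ℚ (ℕtoℚ a) (ℕtoℚ b)) ⟩
  1ℚ + ℕtoℚ a + ℕtoℚ b        ≡⟨ cong (_+ ℕtoℚ b) (sym (ℕtoℚ-suc a)) ⟩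
  ℕtoℚ (suc a) + ℕtoℚ b       ∎
  where open ≡-Reasoning

ℕtoℚ-mono : ∀ {a b} → a ℕ.≤ b → ℕtoℚ a ≤ ℕtoℚ b
ℕtoℚ-mono {a} a≤b with ℕ.m≤n⇒∃[o]m+o≡n a≤b
... | d , refl = subst (ℕtoℚ a ≤_) (sym (ℕtoℚ-+ a d)) (p≤p+q (ℕtoℚ a) (ℕtoℚ-nonneg d))

*-nonneg : ∀ {p q} → 0ℚ ≤ p → 0ℚ ≤ q → 0ℚ ≤ p * q
*-nonneg {p} {q} 0≤p 0≤q = subst (_≤ p * q) (ℚ.*-zeroʳ p) (*-monoˡ-≤ 0≤p 0≤q)

p≤q⇒0≤q-p : ∀ {p q} → p ≤ q → 0ℚ ≤ q - p
p≤q⇒0≤q-p {p} {q} p≤q = subst (_≤ q - p) (ℚ.+-inverseʳ p) (ℚ.+-monoˡ-≤ (- p) p≤q)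

1+p≤q⇒p≤q-1 : ∀ {p q} → 1ℚ + p ≤ q → p ≤ q - 1ℚ
1+p≤q⇒p≤q-1 {p} {q} 1+p≤q =
  subst (_≤ q - 1ℚ) (solve 1 (λ x → (con 1ℚ :+ x) :- con 1ℚ := x) refl p) (ℚ.+-monoˡ-≤ (- 1ℚ) 1+p≤q)

*-swapʳ : ∀ p q r → p * q * r ≡ p * r * q
*-swapʳ = solve 3 (λ p q r → p :* q :* r := p :* r :* q) refl

*-swapˡ : ∀ p q r → p * (q * r) ≡ q * (p * r)
*-swapˡ = solve 3 (λ p q r → p :* (q :* r) := q :* (p :* r)) refl

-- recip 0 = 0 is a junk value; recip is only ever applied to positive counts.
recip : ℕ → ℚ
recip zero    = 0ℚ
recip (suc k) = + 1 / suc k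

recip≡mkℚ : ∀ k → recip (suc k) ≡ mkℚ (+ 1) k (1-coprimeTo (suc k))
recip≡mkℚ k = ℚ.↥p/↧p≡p (mkℚ (+ 1) k (1-coprimeTo (suc k)))

recip-nonneg : ∀ k → 0ℚ ≤ recip k
recip-nonneg zero    = ℚ.≤-refl
recip-nonneg (suc k) = subst (0ℚ ≤_) (sym (recip≡mkℚ k)) (ℚ.nonNegative⁻¹ _)

ℕtoℚ*recip : ∀ {k} → 0 ℕ.< k → ℕtoℚ k * recip k ≡ 1ℚ
ℕtoℚ*recip {suc k} _ =
  trans (cong₂ _*_ (ℕtoℚ≡mkℚ (suc k)) (recip≡mkℚ k))
        (ℚ.*-inverseʳ (mkℚ (+ suc k) 0 (coprime-sym (1-coprimeTo (suc k)))))

*recip*ℕtoℚ : ∀ p {k} → 0 ℕ.< k → p * recip k * ℕtoℚ k ≡ p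
*recip*ℕtoℚ p {k} k>0 = begin
  p * recip k * ℕtoℚ k      ≡⟨ ℚ.*-assoc p (recip k) (ℕtoℚ k) ⟩
  p * (recip k * ℕtoℚ k)    ≡⟨ cong (p *_) (trans (ℚ.*-comm (recip k) (ℕtoℚ k)) (ℕtoℚ*recip k>0)) ⟩
  p * 1ℚ                    ≡⟨ ℚ.*-identityʳ p ⟩
  p                         ∎
  where open ≡-Reasoning

≤-*recip : ∀ {θ c} k → 0 ℕ.< k → θ * ℕtoℚ k ≤ c → θ ≤ c * recip k
≤-*recip {θ} {c} k k>0 θk≤c = begin
  θ                          ≡⟨ sym (*recip*ℕtoℚ θ k>0) ⟩
  θ * recip k * ℕtoℚ k       ≡⟨ *-swapʳ θ (recip k) (ℕtoℚ k) ⟩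
  θ * ℕtoℚ k * recip k       ≤⟨ *-monoʳ-≤ (recip-nonneg k) θk≤c ⟩
  c * recip k                ∎
  where open ℚ.≤-Reasoning

*recip-≤ : ∀ γ {c k} a → 0 ℕ.< k → γ * ℕtoℚ a ≤ c * ℕtoℚ k → γ * recip k * ℕtoℚ a ≤ c
*recip-≤ γ {c} {k} a k>0 γa≤ck = begin
  γ * recip k * ℕtoℚ a       ≡⟨ *-swapʳ γ (recip k) (ℕtoℚ a) ⟩
  γ * ℕtoℚ a * recip k       ≤⟨ *-monoʳ-≤ (recip-nonneg k) γa≤ck ⟩
  c * ℕtoℚ k * recip k       ≡⟨ *-swapʳ c (ℕtoℚ k) (recip k) ⟩
  c * recip k * ℕtoℚ k       ≡⟨ *recip*ℕtoℚ c k>0 ⟩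
  c                          ∎
  where open ℚ.≤-Reasoning

H-mono : ∀ {a b} → a ℕ.≤ b → H a ≤ H b
H-mono {b = zero}  z≤n = ℚ.≤-refl
H-mono {a} {suc b} a≤1+b with ℕ.m≤n⇒m<n∨m≡n a≤1+b
... | inj₂ refl      = ℚ.≤-refl
... | inj₁ (s≤s a≤b) = ℚ.≤-trans (H-mono a≤b) (p≤p+q (H b) (recip-nonneg (suc b)))

-- Since θ ≤ c/i for every i ≤ b + d, θ d ≤ c (1/(b+1) + … + 1/(b+d)) = c (H (b + d) − H b).
harmonic-charge : ∀ {θ c} b d → 0ℚ ≤ θ → (0 ℕ.< d → θ * ℕtoℚ (b ℕ.+ d) ≤ c) →
                  θ * ℕtoℚ d + c * H b ≤ c * H (b ℕ.+ d)
harmonic-charge {θ} {c} b zero _ _ = ℚ.≤-reflexive (begin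
  θ * 0ℚ + c * H b      ≡⟨ cong (_+ c * H b) (ℚ.*-zeroʳ θ) ⟩
  0ℚ + c * H b          ≡⟨ ℚ.+-identityˡ (c * H b) ⟩
  c * H b               ≡⟨ cong (λ i → c * H i) (sym (ℕ.+-identityʳ b)) ⟩
  c * H (b ℕ.+ 0)       ∎)
  where open ≡-Reasoning
harmonic-charge {θ} {c} b (suc d) 0≤θ θ[b+d]≤c = begin
  θ * ℕtoℚ (suc d) + c * H b         ≡⟨ cong (λ z → θ * z + c * H b) (ℕtoℚ-suc d) ⟩
  θ * (1ℚ + ℕtoℚ d) + c * H b        ≡⟨ solve 4 (λ t o x y → t :* (o :+ x) :+ y := t :* o :+ (t :* x :+ y))
                                                refl θ 1ℚ (ℕtoℚ d) (c * H b) ⟩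
  θ * 1ℚ + (θ * ℕtoℚ d + c * H b)    ≤⟨ ℚ.+-mono-≤ θ≤c/[N+1] (harmonic-charge b d 0≤θ λ _ → θN≤c) ⟩
  c * recip (suc N) + c * H N        ≡⟨ solve 3 (λ x y z → x :* y :+ x :* z := x :* (z :+ y))
                                                refl c (recip (suc N)) (H N) ⟩
  c * H (suc N)                      ≡⟨ cong (λ i → c * H i) (sym (ℕ.+-suc b d)) ⟩
  c * H (b ℕ.+ suc d)                ∎
  where
  open ℚ.≤-Reasoning
  N : ℕ
  N = b ℕ.+ d
  θ[N+1]≤c : θ * ℕtoℚ (suc N) ≤ c
  θ[N+1]≤c = subst (λ i → θ * ℕtoℚ i ≤ c) (ℕ.+-suc b d) (θ[b+d]≤c (s≤s z≤n))
  θ≤c/[N+1] : θ * 1ℚ ≤ c * recip (suc N)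
  θ≤c/[N+1] =
    subst (_≤ c * recip (suc N)) (sym (ℚ.*-identityʳ θ)) (≤-*recip (suc N) (s≤s z≤n) θ[N+1]≤c)
  θN≤c : θ * ℕtoℚ N ≤ c
  θN≤c = ℚ.≤-trans (*-monoˡ-≤ 0≤θ (ℕtoℚ-mono (ℕ.n≤1+n N))) θ[N+1]≤c

∑ : ∀ {A : Set} → List A → (A → ℚ) → ℚ
∑ xs f = foldr (λ x acc → f x + acc) 0ℚ xs

infix 5 ∑
syntax ∑ xs (λ x → e) = ∑[ x ∈ xs ] e

𝟙 : Bool → ℚ
𝟙 true  = 1ℚ
𝟙 false = 0ℚ

module _ {A : Set} where

  ∑-cong : ∀ (xs : List A) {f g : A → ℚ} → (∀ {x} → x ∈ xs → f x ≡ g x) → ∑ xs f ≡ ∑ xs g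
  ∑-cong []       _   = refl
  ∑-cong (x ∷ xs) f≡g = cong₂ _+_ (f≡g (here refl)) (∑-cong xs (f≡g ∘ there))

  ∑-mono : ∀ (xs : List A) {f g : A → ℚ} → (∀ {x} → x ∈ xs → f x ≤ g x) → ∑ xs f ≤ ∑ xs g
  ∑-mono []       _   = ℚ.≤-refl
  ∑-mono (x ∷ xs) f≤g = ℚ.+-mono-≤ (f≤g (here refl)) (∑-mono xs (f≤g ∘ there))

  ∑-0 : ∀ (xs : List A) → ∑[ x ∈ xs ] 0ℚ ≡ 0ℚ
  ∑-0 []       = refl
  ∑-0 (x ∷ xs) = trans (ℚ.+-identityˡ _) (∑-0 xs)

  ∑-+ : ∀ (xs : List A) (f g : A → ℚ) → ∑[ x ∈ xs ] (f x + g x) ≡ ∑ xs f + ∑ xs g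
  ∑-+ []       f g = refl
  ∑-+ (x ∷ xs) f g = trans (cong (_+_ (f x + g x)) (∑-+ xs f g))
    (solve 4 (λ a b c d → (a :+ b) :+ (c :+ d) := (a :+ c) :+ (b :+ d))
             refl (f x) (g x) (∑ xs f) (∑ xs g))

  ∑-*ˡ : ∀ (xs : List A) q (f : A → ℚ) → ∑[ x ∈ xs ] q * f x ≡ q * ∑ xs f
  ∑-*ˡ []       q f = sym (ℚ.*-zeroʳ q)
  ∑-*ˡ (x ∷ xs) q f =
    trans (cong (_+_ (q * f x)) (∑-*ˡ xs q f)) (sym (ℚ.*-distribˡ-+ q (f x) (∑ xs f)))

  ∑-𝟙 : ∀ {P : A → Set} (P? : Decidable P) xs →
        ∑[ x ∈ xs ] 𝟙 (does (P? x)) ≡ ℕtoℚ (length (filter P? xs))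
  ∑-𝟙 P? []       = refl
  ∑-𝟙 P? (x ∷ xs) with does (P? x)
  ... | true  = trans (cong (_+_ 1ℚ) (∑-𝟙 P? xs)) (sym (ℕtoℚ-suc (length (filter P? xs))))
  ... | false = trans (ℚ.+-identityˡ _) (∑-𝟙 P? xs)

∑-swap : ∀ {A B : Set} (xs : List A) (ys : List B) (f : A → B → ℚ) →
         ∑[ x ∈ xs ] ∑[ y ∈ ys ] f x y ≡ ∑[ y ∈ ys ] ∑[ x ∈ xs ] f x y
∑-swap []       ys f = sym (∑-0 ys)
∑-swap (x ∷ xs) ys f =
  trans (cong (_+_ (∑ ys (f x))) (∑-swap xs ys f)) (sym (∑-+ ys (f x) λ y → ∑[ x′ ∈ xs ] f x′ y))

if-then-0 : ∀ b q → (if b then q else 0ℚ) ≡ 𝟙 b * q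
if-then-0 true  q = sym (ℚ.*-identityˡ q)
if-then-0 false q = sym (ℚ.*-zeroˡ q)

𝟙-∧ : ∀ a b → 𝟙 (a ∧ b) ≡ 𝟙 a * 𝟙 b
𝟙-∧ true  b = sym (ℚ.*-identityˡ (𝟙 b))
𝟙-∧ false b = sym (ℚ.*-zeroˡ (𝟙 b))

𝟙-guard : ∀ {P : Set} (P? : Dec P) {p q} → (P → p ≤ q) → 𝟙 (does P?) * p ≤ 𝟙 (does P?) * q
𝟙-guard (yes P) p≤q = *-monoˡ-≤ (ℚ.nonNegative⁻¹ 1ℚ) (p≤q P)
𝟙-guard (no _) {p} {q} _ = ℚ.≤-reflexive (trans (ℚ.*-zeroˡ p) (sym (ℚ.*-zeroˡ q)))

module _ {n : ℕ} (E Tr : BRel n) where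

  linkSum-cong : ∀ {f g : Fin n → Fin n → ℚ} → (∀ a b → isLink E Tr a b ≡ true → f a b ≡ g a b) →
                 linkSum E Tr f ≡ linkSum E Tr g
  linkSum-cong {f} {g} f≡g = ∑-cong (allFin n) λ {a} _ → ∑-cong (allFin n) λ {b} _ → on-link a b
    where
    on-link : ∀ a b → (if isLink E Tr a b then f a b else 0ℚ) ≡
                      (if isLink E Tr a b then g a b else 0ℚ)
    on-link a b with isLink E Tr a b in link
    ... | true  = f≡g a b link
    ... | false = refl

  linkSum-mono : ∀ {f g : Fin n → Fin n → ℚ} → (∀ a b → isLink E Tr a b ≡ true → f a b ≤ g a b) →
                 linkSum E Tr f ≤ linkSum E Tr g
  linkSum-mono {f} {g} f≤g = ∑-mono (allFin n) λ {a} _ → ∑-mono (allFin n) λ {b} _ → on-link a b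
    where
    on-link : ∀ a b → (if isLink E Tr a b then f a b else 0ℚ) ≤
                      (if isLink E Tr a b then g a b else 0ℚ)
    on-link a b with isLink E Tr a b in link
    ... | true  = f≤g a b link
    ... | false = ℚ.≤-refl

  linkSum-*ˡ : ∀ q (f : Fin n → Fin n → ℚ) → linkSum E Tr (λ a b → q * f a b) ≡ q * linkSum E Tr f
  linkSum-*ˡ q f =
    trans (∑-cong (allFin n) λ {a} _ →
             trans (∑-cong (allFin n) λ {b} _ → if-* (isLink E Tr a b) (f a b)) (∑-*ˡ (allFin n) q _))
          (∑-*ˡ (allFin n) q _)
    where
    if-* : ∀ l r → (if l then q * r else 0ℚ) ≡ q * (if l then r else 0ℚ)
    if-* true  r = refl
    if-* false r = sym (ℚ.*-zeroʳ q)

  ∑-linkSum : ∀ {A : Set} (xs : List A) (g : A → Fin n → Fin n → ℚ) →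
              ∑[ y ∈ xs ] linkSum E Tr (g y) ≡ linkSum E Tr (λ a b → ∑[ y ∈ xs ] g y a b)
  ∑-linkSum xs g =
    trans (∑-swap xs (allFin n) λ y a → ∑[ b ∈ allFin n ] (if isLink E Tr a b then g y a b else 0ℚ))
          (∑-cong (allFin n) λ {a} _ →
             trans (∑-swap xs (allFin n) λ y b → if isLink E Tr a b then g y a b else 0ℚ)
                   (∑-cong (allFin n) λ {b} _ → ∑-if (isLink E Tr a b) a b))
    where
    ∑-if : ∀ l a b → ∑[ y ∈ xs ] (if l then g y a b else 0ℚ) ≡
                     (if l then ∑[ y ∈ xs ] g y a b else 0ℚ)
    ∑-if true  a b = refl
    ∑-if false a b = ∑-0 xs

range : ℕ → ℕ → List ℕ
range s zero    = []
range s (suc L) = s ∷ range (suc s) L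

∈-range⇒< : ∀ {s L j} → j ∈ range s L → j ℕ.< s ℕ.+ L
∈-range⇒< {s} {suc L} (here refl) = ℕ.m<m+n s (s≤s z≤n)
∈-range⇒< {s} {suc L} {j} (there j∈) = subst (j ℕ.<_) (sym (ℕ.+-suc s L)) (∈-range⇒< j∈)

+-suc≡⇒< : ∀ {s L m} → s ℕ.+ suc L ≡ m → s ℕ.< m
+-suc≡⇒< {s} {L} s+1+L≡m = subst (s ℕ.<_) s+1+L≡m (ℕ.m<m+n s (s≤s z≤n))

∑-range-suc : ∀ s L (f : ℕ → ℚ) → ∑[ j ∈ range (suc s) L ] f j ≡ ∑[ j ∈ range s L ] f (suc j)
∑-range-suc s zero    f = refl
∑-range-suc s (suc L) f = cong (_+_ (f (suc s))) (∑-range-suc (suc s) L f)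

-- Abel summation and harmonic charging

module Summation (m : ℕ) (θ : ℕ → ℚ) where

  θ₋ : ℕ → ℚ
  θ₋ zero    = 0ℚ
  θ₋ (suc j) = θ j

  Δ : ℕ → ℚ
  Δ j = θ j - θ₋ j

  abel : ∀ (κ : ℕ → ℚ) L s → s ℕ.+ L ≡ m →
         ∑[ j ∈ range s L ] θ j * κ j ≡
         θ₋ s * (∑[ j ∈ range s L ] κ j) +
         (∑[ j ∈ range s L ] Δ j * (∑[ i ∈ range j (m ∸ j) ] κ i))
  abel κ zero    s _   = sym (trans (cong (_+ 0ℚ) (ℚ.*-zeroʳ (θ₋ s))) (ℚ.+-identityʳ 0ℚ))
  abel κ (suc L) s s+1+L≡m = begin
    θ s * κ s + (∑[ j ∈ range (suc s) L ] θ j * κ j)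
      ≡⟨ cong (_+_ (θ s * κ s)) (abel κ L (suc s) (trans (sym (ℕ.+-suc s L)) s+1+L≡m)) ⟩
    θ s * κ s + (θ s * K′ + Σ′)
      ≡⟨ solve 5 (λ t p k K S → t :* k :+ (t :* K :+ S) :=
                                 p :* (k :+ K) :+ ((t :- p) :* (k :+ K) :+ S))
               refl (θ s) (θ₋ s) (κ s) K′ Σ′ ⟩
    θ₋ s * (κ s + K′) + (Δ s * (κ s + K′) + Σ′)
      ≡⟨ cong (λ L′ → θ₋ s * (κ s + K′) + (Δ s * ∑ (range s L′) κ + Σ′)) (sym m∸s≡1+L) ⟩
    θ₋ s * (κ s + K′) + (Δ s * (∑[ i ∈ range s (m ∸ s) ] κ i) + Σ′) ∎
    where
    open ≡-Reasoning
    K′ Σ′ : ℚ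
    K′ = ∑[ j ∈ range (suc s) L ] κ j
    Σ′ = ∑[ j ∈ range (suc s) L ] Δ j * (∑[ i ∈ range j (m ∸ j) ] κ i)
    m∸s≡1+L : m ∸ s ≡ suc L
    m∸s≡1+L = trans (cong (_∸ s) (sym s+1+L≡m)) (ℕ.m+n∸m≡n s (suc L))

  module _ (c : ℚ) (a : ℕ → ℕ)
           (a-antitone : ∀ j → j ℕ.< m → a (suc j) ℕ.≤ a j) (a-final : a m ≡ 0)
           (θ-nonneg : ∀ j → j ℕ.< m → 0ℚ ≤ θ j)
           (θa≤c : ∀ j → j ℕ.< m → 0 ℕ.< a j → θ j * ℕtoℚ (a j) ≤ c) where

    -- The term θ₋ s * a s makes the statement inductive in s.
    charge : ∀ L s → s ℕ.+ L ≡ m →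
             (∑[ j ∈ range s L ] Δ j * ℕtoℚ (a j)) + θ₋ s * ℕtoℚ (a s) ≤ c * H (a s)
    charge zero s s+0≡m rewrite trans (cong a (trans (sym (ℕ.+-identityʳ s)) s+0≡m)) a-final =
      ℚ.≤-reflexive (trans (ℚ.+-identityˡ _) (trans (ℚ.*-zeroʳ (θ₋ s)) (sym (ℚ.*-zeroʳ c))))
    charge (suc L) s s+1+L≡m = split (ℕ.m≤n⇒∃[o]m+o≡n (a-antitone s s<m))
      where
      s<m : s ℕ.< m
      s<m = +-suc≡⇒< s+1+L≡m
      a′ : ℕ
      a′ = a (suc s)
      S′ : ℚ
      S′ = ∑[ j ∈ range (suc s) L ] Δ j * ℕtoℚ (a j)
      split : (∃ λ d → a′ ℕ.+ d ≡ a s) → (Δ s * ℕtoℚ (a s) + S′) + θ₋ s * ℕtoℚ (a s) ≤ c * H (a s)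
      split (d , a′+d≡a) = begin
        (Δ s * ℕtoℚ (a s) + S′) + θ₋ s * ℕtoℚ (a s)
          ≡⟨ solve 4 (λ t p x y → (t :- p) :* x :+ y :+ p :* x := t :* x :+ y)
                     refl (θ s) (θ₋ s) (ℕtoℚ (a s)) S′ ⟩
        θ s * ℕtoℚ (a s) + S′
          ≡⟨ cong (λ z → θ s * z + S′) (trans (cong ℕtoℚ (sym a′+d≡a)) (ℕtoℚ-+ a′ d)) ⟩
        θ s * (ℕtoℚ a′ + ℕtoℚ d) + S′
          ≡⟨ solve 4 (λ t x y S → t :* (x :+ y) :+ S := t :* y :+ (S :+ t :* x))
                     refl (θ s) (ℕtoℚ a′) (ℕtoℚ d) S′ ⟩
        θ s * ℕtoℚ d + (S′ + θ s * ℕtoℚ a′)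
          ≤⟨ ℚ.+-monoʳ-≤ (θ s * ℕtoℚ d) (charge L (suc s) (trans (sym (ℕ.+-suc s L)) s+1+L≡m)) ⟩
        θ s * ℕtoℚ d + c * H a′
          ≤⟨ harmonic-charge a′ d (θ-nonneg s s<m) charge≤c ⟩
        c * H (a′ ℕ.+ d)
          ≡⟨ cong (λ z → c * H z) a′+d≡a ⟩
        c * H (a s) ∎
        where
        open ℚ.≤-Reasoning
        charge≤c : 0 ℕ.< d → θ s * ℕtoℚ (a′ ℕ.+ d) ≤ c
        charge≤c d>0 = subst (λ z → θ s * ℕtoℚ z ≤ c) (sym a′+d≡a)
          (θa≤c s s<m (subst (0 ℕ.<_) a′+d≡a (ℕ.<-≤-trans d>0 (ℕ.m≤n+m d a′))))

-- ℓ j is the link picked in iteration j < m and A j e stands for |inc^j(e)|.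
module GreedyAccounting {n : ℕ} (E Tr : BRel n) (c x : Fin n → Fin n → ℚ)
                        (m : ℕ) (ℓ : ℕ → Link n) (A : ℕ → Link n → ℕ) where

  k : ℕ → ℕ
  k j = A j (ℓ j)

  θ : ℕ → ℚ
  θ j = lcost c (ℓ j) * recip (k j)

  open Summation m θ

  module _ (c-nonneg : ∀ a b → isLink E Tr a b ≡ true → 0ℚ ≤ c a b)
           (x-nonneg : ∀ a b → isLink E Tr a b ≡ true → 0ℚ ≤ x a b)
           (ℓ-link : ∀ j → j ℕ.< m → isLink E Tr (proj₁ (ℓ j)) (proj₂ (ℓ j)) ≡ true)
           (k-pos : ∀ j → j ℕ.< m → 0 ℕ.< k j)
           (greedy : ∀ j → j ℕ.< m → ∀ a b → isLink E Tr a b ≡ true → 0 ℕ.< A j (a , b) →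
                     lcost c (ℓ j) * ℕtoℚ (A j (a , b)) ≤ c a b * ℕtoℚ (k j))
           (A-antitone : ∀ j e → A (suc j) e ℕ.≤ A j e)
           (A-final : ∀ e → A m e ≡ 0)
           (covering : ∀ j → j ℕ.< m → ∑[ i ∈ range j (m ∸ j) ] ℕtoℚ (k i) ≤
                                      linkSum E Tr (λ a b → x a b * ℕtoℚ (A j (a , b))))
           (λ′ : ℕ) (A-initial : ∀ a b → isLink E Tr a b ≡ true → A 0 (a , b) ℕ.≤ λ′)
    where

    θ-nonneg : ∀ j → j ℕ.< m → 0ℚ ≤ θ j
    θ-nonneg j j<m = *-nonneg (c-nonneg _ _ (ℓ-link j j<m)) (recip-nonneg (k j))

    θ*A≤c : ∀ j → j ℕ.< m → ∀ a b → isLink E Tr a b ≡ true → 0 ℕ.< A j (a , b) →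
            θ j * ℕtoℚ (A j (a , b)) ≤ c a b
    θ*A≤c j j<m a b link A>0 =
      *recip-≤ (lcost c (ℓ j)) (A j (a , b)) (k-pos j j<m) (greedy j j<m a b link A>0)

    θ-mono : ∀ j → suc j ℕ.< m → θ j ≤ θ (suc j)
    θ-mono j 1+j<m = ≤-*recip (k (suc j)) (k-pos (suc j) 1+j<m)
      (ℚ.≤-trans (*-monoˡ-≤ (θ-nonneg j j<m) (ℕtoℚ-mono k≤A)) (θ*A≤c j j<m _ _ (ℓ-link (suc j) 1+j<m) A>0))
      where
      j<m : j ℕ.< m
      j<m = ℕ.<-trans (ℕ.n<1+n j) 1+j<m
      k≤A : k (suc j) ℕ.≤ A j (ℓ (suc j))
      k≤A = A-antitone j (ℓ (suc j))
      A>0 : 0 ℕ.< A j (ℓ (suc j))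
      A>0 = ℕ.<-≤-trans (k-pos (suc j) 1+j<m) k≤A

    Δ-nonneg : ∀ j → j ℕ.< m → 0ℚ ≤ Δ j
    Δ-nonneg zero    0<m   = p≤q⇒0≤q-p (θ-nonneg 0 0<m)
    Δ-nonneg (suc j) 1+j<m = p≤q⇒0≤q-p (θ-mono j 1+j<m)

    charged : ∀ a b → isLink E Tr a b ≡ true →
              ∑[ j ∈ range 0 m ] Δ j * ℕtoℚ (A j (a , b)) ≤ c a b * H λ′
    charged a b link = ℚ.≤-trans (subst (_≤ c a b * H (A 0 (a , b))) S+0*A≡S charged-from-0)
                                 (*-monoˡ-≤ (c-nonneg a b link) (H-mono (A-initial a b link)))
      where
      S : ℚ
      S = ∑[ j ∈ range 0 m ] Δ j * ℕtoℚ (A j (a , b))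
      S+0*A≡S : S + 0ℚ * ℕtoℚ (A 0 (a , b)) ≡ S
      S+0*A≡S = trans (cong (_+_ S) (ℚ.*-zeroˡ (ℕtoℚ (A 0 (a , b))))) (ℚ.+-identityʳ S)
      charged-from-0 : S + θ₋ 0 * ℕtoℚ (A 0 (a , b)) ≤ c a b * H (A 0 (a , b))
      charged-from-0 = charge (c a b) (λ j → A j (a , b)) (λ j _ → A-antitone j (a , b)) (A-final (a , b))
                              θ-nonneg (λ j j<m → θ*A≤c j j<m a b link) m 0 refl

    exchange : ∑[ j ∈ range 0 m ] Δ j * linkSum E Tr (λ a b → x a b * ℕtoℚ (A j (a , b))) ≡
               linkSum E Tr (λ a b → x a b * (∑[ j ∈ range 0 m ] Δ j * ℕtoℚ (A j (a , b))))
    exchange = begin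
      ∑[ j ∈ range 0 m ] Δ j * linkSum E Tr (λ a b → x a b * ℕtoℚ (A j (a , b)))
        ≡⟨ ∑-cong (range 0 m) (λ {j} _ → sym (linkSum-*ˡ E Tr (Δ j) _)) ⟩
      ∑[ j ∈ range 0 m ] linkSum E Tr (λ a b → Δ j * (x a b * ℕtoℚ (A j (a , b))))
        ≡⟨ ∑-linkSum E Tr (range 0 m) _ ⟩
      linkSum E Tr (λ a b → ∑[ j ∈ range 0 m ] Δ j * (x a b * ℕtoℚ (A j (a , b))))
        ≡⟨ linkSum-cong E Tr (λ a b _ → trans (∑-cong (range 0 m) λ {j} _ → *-swapˡ (Δ j) (x a b) _)
                                             (∑-*ˡ (range 0 m) (x a b) _)) ⟩
      linkSum E Tr (λ a b → x a b * (∑[ j ∈ range 0 m ] Δ j * ℕtoℚ (A j (a , b)))) ∎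
      where open ≡-Reasoning

    greedy-cost-bound : ∑[ j ∈ range 0 m ] lcost c (ℓ j) ≤ H λ′ * linkSum E Tr (λ a b → c a b * x a b)
    greedy-cost-bound = begin
      ∑[ j ∈ range 0 m ] lcost c (ℓ j)
        ≡⟨ ∑-cong (range 0 m) (λ {j} j∈ → sym (*recip*ℕtoℚ (lcost c (ℓ j)) (k-pos j (∈-range⇒< j∈)))) ⟩
      ∑[ j ∈ range 0 m ] θ j * ℕtoℚ (k j)
        ≡⟨ abel (ℕtoℚ ∘ k) m 0 refl ⟩
      0ℚ * Σk + ΣΔK
        ≡⟨ trans (cong (_+ ΣΔK) (ℚ.*-zeroˡ Σk)) (ℚ.+-identityˡ ΣΔK) ⟩
      ∑[ j ∈ range 0 m ] Δ j * K j
        ≤⟨ ∑-mono (range 0 m) (λ {j} j∈ → let j<m = ∈-range⇒< j∈ in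
                                *-monoˡ-≤ (Δ-nonneg j j<m) (covering j j<m)) ⟩
      ∑[ j ∈ range 0 m ] Δ j * linkSum E Tr (λ a b → x a b * ℕtoℚ (A j (a , b)))
        ≡⟨ exchange ⟩
      linkSum E Tr (λ a b → x a b * (∑[ j ∈ range 0 m ] Δ j * ℕtoℚ (A j (a , b))))
        ≤⟨ linkSum-mono E Tr (λ a b link → *-monoˡ-≤ (x-nonneg a b link) (charged a b link)) ⟩
      linkSum E Tr (λ a b → x a b * (c a b * H λ′))
        ≡⟨ linkSum-cong E Tr (λ a b _ → solve 3 (λ x c h → x :* (c :* h) := h :* (c :* x))
                                                refl (x a b) (c a b) (H λ′)) ⟩
      linkSum E Tr (λ a b → H λ′ * (c a b * x a b))
        ≡⟨ linkSum-*ˡ E Tr (H λ′) _ ⟩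
      H λ′ * linkSum E Tr (λ a b → c a b * x a b) ∎
      where
      open ℚ.≤-Reasoning
      K : ℕ → ℚ
      K j = ∑[ i ∈ range j (m ∸ j) ] ℕtoℚ (k i)
      Σk ΣΔK : ℚ
      Σk  = ∑[ j ∈ range 0 m ] ℕtoℚ (k j)
      ΣΔK = ∑[ j ∈ range 0 m ] Δ j * K j

-- Components of a graph minus a node

module Components {n : ℕ} (R : Fin n → Fin n → Set) (R-sym : ∀ {a b} → R a b → R b a)
                  (u : Fin n) (reach? : ∀ a b → Dec (Reach R (_≢ u) a b)) where

  infix 4 _~_
  _~_ : Fin n → Fin n → Set
  a ~ b = Reach R (_≢ u) a b

  ~-sym : ∀ {a b} → a ~ b → b ~ a
  ~-sym = reach-sym R-sym

  -- Each component of R − u is labelled by its least node; label u is junk.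
  label : Fin n → Fin n
  label v = fromMaybe v (least (λ w → reach? w v))

  least≡label : ∀ {v} → v ≢ u → least (λ w → reach? w v) ≡ just (label v)
  least≡label {v} v≢u
    with least (λ w → reach? w v) | least-complete (λ w → reach? w v) (reach-refl v≢u)
  ... | .(just w) | w , refl = refl

  label~ : ∀ {v} → v ≢ u → label v ~ v
  label~ {v} v≢u = least-sound (λ w → reach? w v) (least≡label v≢u)

  label≢u : ∀ {v} → v ≢ u → label v ≢ u
  label≢u v≢u = reach-head (label~ v≢u)

  label-minimal : ∀ {v w} → v ≢ u → w <ᶠ label v → ¬ (w ~ v)
  label-minimal {v} v≢u = least-minimal (λ w → reach? w v) (least≡label v≢u)

  label-unique : ∀ {v r} → r ~ v → (∀ {w} → w <ᶠ r → ¬ (w ~ v)) → label v ≡ r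
  label-unique {v} r~v below = cong (fromMaybe v) (least-unique (λ w → reach? w v) r~v below)

  label-cong : ∀ {v w} → v ~ w → label v ≡ label w
  label-cong {v} {w} v~w = Maybe.just-injective (begin
    just (label v)            ≡⟨ sym (least≡label (reach-head v~w)) ⟩
    least (λ z → reach? z v)  ≡⟨ least-cong (λ z → reach? z v) (λ z → reach? z w)
                                            (λ z~v → reach-trans z~v v~w) (λ z~w → reach-trans z~w (~-sym v~w)) ⟩
    least (λ z → reach? z w)  ≡⟨ least≡label (reach-last v~w) ⟩
    just (label w)            ∎)
    where open ≡-Reasoning

  label≡⇒~ : ∀ {v w} → v ≢ u → w ≢ u → label v ≡ label w → v ~ w
  label≡⇒~ {v} {w} v≢u w≢u eq = reach-trans (~-sym (label~ v≢u)) (subst (_~ w) (sym eq) (label~ w≢u))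

  label-refines : ∀ {Tr : BRel n} → (∀ {a b} → Adj Tr a b → R a b) → InPi Tr u label
  label-refines T⊆R _ _ _ _ v~w = label-cong (reach-mono T⊆R v~w)

  IsLabel : Fin n → Set
  IsLabel r = ∃ λ v → v ≢ u × label v ≡ r

  isLabel? : Decidable IsLabel
  isLabel? r = Fin.any? λ v → ¬? (v ≟ u) ×-dec (label v ≟ r)

  label-fixed : ∀ {r} → IsLabel r → label r ≡ r
  label-fixed (v , v≢u , refl) = label-cong (label~ v≢u)

  parts : ℕ
  parts = count isLabel?

  numParts : NumParts u label parts
  numParts = Card-count isLabel?

  parts-pos : ∀ {v} → v ≢ u → 0 ℕ.< parts
  parts-pos v≢u = Card-< Card-∅ numParts (λ ()) (_ , v≢u , refl) (λ ())

  Crosses : Fin n → Fin n → Set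
  Crosses a b = a ≢ u × b ≢ u × ¬ (a ~ b)

  crosses? : ∀ a b → Dec (Crosses a b)
  crosses? a b = ¬? (a ≟ u) ×-dec ¬? (b ≟ u) ×-dec ¬? (reach? a b)

  crossesP-label : ∀ a b → crossesP u label a b ≡ does (crosses? a b)
  crossesP-label a b with a ≟ u | b ≟ u
  ... | yes _  | _      = refl
  ... | no _   | yes _  = refl
  ... | no a≢u | no b≢u =
    cong not (trans (isYes≗does (label a ≟ label b))
                    (does-⇔ (mk⇔ (label≡⇒~ a≢u b≢u) label-cong) (label a ≟ label b) (reach? a b)))

module Refinement {n : ℕ} (R R′ : Fin n → Fin n → Set)
                  (R-sym : ∀ {a b} → R a b → R b a) (R′-sym : ∀ {a b} → R′ a b → R′ b a)
                  (R⊆R′ : ∀ {a b} → R a b → R′ a b) (u : Fin n)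
                  (reach? : ∀ a b → Dec (Reach R (_≢ u) a b))
                  (reach′? : ∀ a b → Dec (Reach R′ (_≢ u) a b)) where

  module C  = Components R  R-sym  u reach?
  module C′ = Components R′ R′-sym u reach′?

  ~⇒~′ : ∀ {a b} → a C.~ b → a C′.~ b
  ~⇒~′ = reach-mono R⊆R′

  -- The least node of a component of R′ − u is also least in its (smaller) component of R − u.
  label-label′ : ∀ {v} → v ≢ u → C.label (C′.label v) ≡ C′.label v
  label-label′ v≢u = C.label-unique (reach-refl (C′.label≢u v≢u))
    λ w<r w~r → C′.label-minimal v≢u w<r (reach-trans (~⇒~′ w~r) (C′.label~ v≢u))

  isLabel-antitone : ∀ {r} → C′.IsLabel r → C.IsLabel r
  isLabel-antitone (v , v≢u , refl) = C′.label v , C′.label≢u v≢u , label-label′ v≢u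

  parts-antitone : C′.parts ℕ.≤ C.parts
  parts-antitone = Card-≤ C′.numParts C.numParts isLabel-antitone

  merged-label : ∀ {a b} → R′ a b → C.Crosses a b → ∃ λ r → C.IsLabel r × ¬ C′.IsLabel r
  merged-label {a} {b} ab (a≢u , b≢u , a≁b) with C′.isLabel? (C.label a) | C′.isLabel? (C.label b)
  ... | no ¬L′a | _       = C.label a , (a , a≢u , refl) , ¬L′a
  ... | yes _   | no ¬L′b = C.label b , (b , b≢u , refl) , ¬L′b
  ... | yes L′a | yes L′b = ⊥-elim (a≁b (C.label≡⇒~ a≢u b≢u (begin
    C.label a               ≡⟨ sym (C′.label-fixed L′a) ⟩
    C′.label (C.label a)    ≡⟨ C′.label-cong (~⇒~′ (C.label~ a≢u)) ⟩
    C′.label a              ≡⟨ C′.label-cong (reach-edge a≢u b≢u ab) ⟩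
    C′.label b              ≡⟨ sym (C′.label-cong (~⇒~′ (C.label~ b≢u))) ⟩
    C′.label (C.label b)    ≡⟨ C′.label-fixed L′b ⟩
    C.label b               ∎)))
    where open ≡-Reasoning

  parts-merge : ∀ {a b} → R′ a b → C.Crosses a b → C′.parts ℕ.< C.parts
  parts-merge ab cr with merged-label ab cr
  ... | r , Lr , ¬L′r = Card-< C′.numParts C.numParts isLabel-antitone Lr ¬L′r

-- The greedy run for 2NC-TAP

module _ {A : Set} where

  nth : A → List A → ℕ → A
  nth d []       _       = d
  nth d (x ∷ _)  zero    = x
  nth d (_ ∷ xs) (suc i) = nth d xs i

  lookup≡nth : ∀ (d : A) xs (i : Fin (length xs)) → lookup xs i ≡ nth d xs (toℕ i)
  lookup≡nth d (x ∷ xs) zero    = refl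
  lookup≡nth d (x ∷ xs) (suc i) = lookup≡nth d xs i

  nth∈take : ∀ (d : A) xs {i} → i ℕ.< length xs → nth d xs i ∈ take (suc i) xs
  nth∈take d (x ∷ xs) {zero}  _         = here refl
  nth∈take d (x ∷ xs) {suc i} (s≤s i<l) = there (nth∈take d xs i<l)

  take-⊆-suc : ∀ (xs : List A) i {y} → y ∈ take i xs → y ∈ take (suc i) xs
  take-⊆-suc (x ∷ xs) (suc i) (here y≡x)  = here y≡x
  take-⊆-suc (x ∷ xs) (suc i) (there y∈) = there (take-⊆-suc xs i y∈)

costList≡∑ : ∀ {n} (c : Fin n → Fin n → ℚ) (d : Link n) xs →
             costList c xs ≡ ∑[ j ∈ range 0 (length xs) ] lcost c (nth d xs j)
costList≡∑ c d []       = refl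
costList≡∑ c d (y ∷ ys) = cong (_+_ (lcost c y))
  (trans (costList≡∑ c d ys) (sym (∑-range-suc 0 (length ys) (λ j → lcost c (nth d (y ∷ ys) j)))))

link⇒edge : ∀ {n} {E Tr : BRel n} {a b} → isLink E Tr a b ≡ true → E a b ≡ true
link⇒edge {E = E} {a = a} {b} = ∧-conicalˡ (E a b) _

link-nonloop : ∀ {n} {E Tr : BRel n} → (∀ i → E i i ≡ false) →
               ∀ {a b} → isLink E Tr a b ≡ true → a ≢ b
link-nonloop {E = E} {Tr} loopless {a} link refl with trans (sym (loopless a)) (link⇒edge {E = E} {Tr} link)
... | ()

another : ∀ {n} → 2 ℕ.≤ n → (u : Fin n) → ∃ (_≢ u)
another {suc (suc _)} _         zero    = suc zero , λ ()
another {suc (suc _)} _         (suc _) = zero , λ ()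
another {suc zero}    (s≤s ())  zero

module GreedyRunAnalysis {n : ℕ} (E Tr : BRel n) (c : Fin n → Fin n → ℚ) (Fs : List (Link n))
  (Tr-sym : ∀ i j → Tr i j ≡ Tr j i)
  (reach? : ∀ s u a b → Dec (Reach (TF Tr (take s Fs)) (_≢ u) a b))
  (nonLeaf? : ∀ u → Dec (NonLeaf Tr u))
  (ℓ₀ : Link n) where

  open import Data.List.Membership.DecPropositional (_≟_ {n}) using (_∈?_)

  m : ℕ
  m = length Fs

  -- ℓ₀ is a dummy value, used only past the end of the run.
  ℓ : ℕ → Link n
  ℓ = nth ℓ₀ Fs

  G : ℕ → Fin n → Fin n → Set
  G s = TF Tr (take s Fs)

  TF-sym : ∀ {Fs′ a b} → TF Tr Fs′ a b → TF Tr Fs′ b a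
  TF-sym {a = a} {b} (inj₁ ab∈T)        = inj₁ (trans (Tr-sym b a) ab∈T)
  TF-sym             (inj₂ (inj₁ ab∈F)) = inj₂ (inj₂ ab∈F)
  TF-sym             (inj₂ (inj₂ ba∈F)) = inj₂ (inj₁ ba∈F)

  G-mono : ∀ {s a b} → G s a b → G (suc s) a b
  G-mono     (inj₁ ab∈T)        = inj₁ ab∈T
  G-mono {s} (inj₂ (inj₁ ab∈F)) = inj₂ (inj₁ (take-⊆-suc Fs s ab∈F))
  G-mono {s} (inj₂ (inj₂ ba∈F)) = inj₂ (inj₂ (take-⊆-suc Fs s ba∈F))

  module Comp (s : ℕ) (u : Fin n) = Components (G s) TF-sym u (reach? s u)
  module Step (s : ℕ) (u : Fin n) =
    Refinement (G s) (G (suc s)) TF-sym TF-sym G-mono u (reach? s u) (reach? (suc s) u)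

  inc? : ∀ s e u → Dec (Inc Tr (take s Fs) e u)
  inc? s (a , b) u = nonLeaf? u ×-dec Comp.crosses? s u a b

  A : ℕ → Link n → ℕ
  A s e = count (inc? s e)

  A-antitone : ∀ s e → A (suc s) e ℕ.≤ A s e
  A-antitone s e = Card-≤ (Card-count (inc? (suc s) e)) (Card-count (inc? s e))
    λ (nl , a≢u , b≢u , a≁b) → nl , a≢u , b≢u , a≁b ∘ reach-mono G-mono

  A-final : TwoNodeConnected n (TF Tr Fs) → ∀ e → A m e ≡ 0
  A-final (_ , _ , 2nc) e = ℕ.n≤0⇒n≡0 (Card-≤ (Card-count (inc? m e)) Card-∅ no-crossing)
    where
    no-crossing : ∀ {u} → ¬ Inc Tr (take m Fs) e u
    no-crossing {u} (_ , a≢u , b≢u , a≁b) =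
      a≁b (subst (λ F → Reach (TF Tr F) (_≢ u) (proj₁ e) (proj₂ e)) (sym (List.take-all m Fs ℕ.≤-refl))
                 (2nc u _ _ a≢u b≢u))

  A-initial : (∀ i → E i i ≡ false) → Connected (Adj Tr) → ∀ {lam} →
              (∀ a b k → isLink E Tr a b ≡ true → TreePathLength Tr a b k → k ℕ.≤ lam) →
              ∀ a b → isLink E Tr a b ≡ true → A 0 (a , b) ℕ.≤ lam ∸ 1
  A-initial loopless Tr-connected {lam} lam-max a b link
    with walk⇒path (proj₁ (proj₂ (Tr-connected a b tt tt)))
  ... | ws , path , ws! =
    ℕ.∸-monoˡ-≤ 1 (ℕ.≤-trans (ℕ.s≤s⁻¹ (subst (_ ℕ.≤_) (walk-length path) A+2≤|ws|))
                             (lam-max a b _ link (ws , path , ws! , walk-length path)))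
    where
    Inc₀ : Fin n → Set
    Inc₀ = Inc Tr [] (a , b)
    ¬Inc₀b : ¬ Inc₀ b
    ¬Inc₀b (_ , _ , b≢b , _) = b≢b refl
    a∉b∪Inc₀ : ¬ (a ≡ b ⊎ Inc₀ a)
    a∉b∪Inc₀ (inj₁ a≡b)              = link-nonloop {E = E} {Tr} loopless link a≡b
    a∉b∪Inc₀ (inj₂ (_ , a≢a , _ , _)) = a≢a refl
    Inc₀⊆ws : ∀ {v} → Inc₀ v → v ∈ ws
    Inc₀⊆ws {v} (_ , _ , _ , a≁b) with v ∈? ws
    ... | yes v∈ws = v∈ws
    ... | no  v∉ws =
      ⊥-elim (a≁b (reach-mono inj₁ (ws , path , All.map (_∘ sym) (¬Any⇒All¬ ws v∉ws))))
    ab∪Inc₀⊆ws : ∀ {v} → v ≡ a ⊎ (v ≡ b ⊎ Inc₀ v) → v ∈ ws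
    ab∪Inc₀⊆ws (inj₁ refl)        = walk-head∈ path
    ab∪Inc₀⊆ws (inj₂ (inj₁ refl)) = walk-last∈ path
    ab∪Inc₀⊆ws (inj₂ (inj₂ inc))  = Inc₀⊆ws inc
    A+2≤|ws| : suc (suc (A 0 (a , b))) ℕ.≤ length ws
    A+2≤|ws| = Card-≤ (Card-insert (Card-insert (Card-count (inc? 0 (a , b))) ¬Inc₀b) a∉b∪Inc₀)
                      (ws , ws! , (λ _ v∈ → v∈) , (λ _ v∈ → v∈) , refl) ab∪Inc₀⊆ws

  crossing? : ∀ u i → Dec (Comp.Crosses i u (proj₁ (ℓ i)) (proj₂ (ℓ i)))
  crossing? u i = Comp.crosses? i u (proj₁ (ℓ i)) (proj₂ (ℓ i))

  -- A step whose link crosses P_u merges two of its parts, and at least one part always remains.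
  crossings<parts : ∀ {u v} → v ≢ u → ∀ L s → s ℕ.+ L ≡ m →
                    length (filter (crossing? u) (range s L)) ℕ.< Comp.parts s u
  crossings<parts v≢u zero s _ = Comp.parts-pos s _ v≢u
  crossings<parts {u} v≢u (suc L) s s+1+L≡m
    with crossings<parts v≢u L (suc s) (trans (sym (ℕ.+-suc s L)) s+1+L≡m) | crossing? u s
  ... | IH | yes cr rewrite List.filter-accept (crossing? u) {xs = range (suc s) L} cr =
    ℕ.≤-trans (s≤s IH) (Step.parts-merge s u (inj₂ (inj₁ (nth∈take ℓ₀ Fs (+-suc≡⇒< s+1+L≡m)))) cr)
  ... | IH | no ¬cr rewrite List.filter-reject (crossing? u) {xs = range (suc s) L} ¬cr =
    ℕ.<-≤-trans IH (Step.parts-antitone s u)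

  module _ (x : Fin n → Fin n → ℚ) (feasible : FeasibleP E Tr x)
           (another : (u : Fin n) → ∃ (_≢ u)) where

    crossings≤feasible : ∀ {u} → NonLeaf Tr u → ∀ {j} → j ℕ.≤ m →
                 ∑[ i ∈ range j (m ∸ j) ] 𝟙 (does (crossing? u i)) ≤
                 linkSum E Tr (λ a b → 𝟙 (does (Comp.crosses? j u a b)) * x a b)
    crossings≤feasible {u} nl {j} j≤m = begin
      ∑[ i ∈ range j (m ∸ j) ] 𝟙 (does (crossing? u i))
        ≡⟨ ∑-𝟙 (crossing? u) (range j (m ∸ j)) ⟩
      ℕtoℚ crossings
        ≤⟨ 1+p≤q⇒p≤q-1 (subst (_≤ ℕtoℚ (Comp.parts j u)) (ℕtoℚ-suc crossings)
                              (ℕtoℚ-mono (crossings<parts v≢u (m ∸ j) j (ℕ.m+[n∸m]≡n j≤m)))) ⟩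
      ℕtoℚ (Comp.parts j u) - 1ℚ
        ≤⟨ proj₂ feasible u nl (Comp.label j u) (Comp.label-refines j u inj₁)
                               (Comp.parts j u) (Comp.numParts j u) ⟩
      linkSum E Tr (λ a b → if crossesP u (Comp.label j u) a b then x a b else 0ℚ)
        ≡⟨ linkSum-cong E Tr (λ a b _ → trans (cong (λ t → if t then x a b else 0ℚ) (Comp.crossesP-label j u a b))
                                              (if-then-0 _ (x a b))) ⟩
      linkSum E Tr (λ a b → 𝟙 (does (Comp.crosses? j u a b)) * x a b) ∎
      where
      open ℚ.≤-Reasoning
      crossings : ℕ
      crossings = length (filter (crossing? u) (range j (m ∸ j)))
      v≢u : proj₁ (another u) ≢ u
      v≢u = proj₂ (another u)

    incidences≤feasible : ∀ {j} → j ℕ.≤ m → ∀ u →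
                    ∑[ i ∈ range j (m ∸ j) ] 𝟙 (does (inc? i (ℓ i) u)) ≤
                    linkSum E Tr (λ a b → 𝟙 (does (inc? j (a , b) u)) * x a b)
    incidences≤feasible {j} j≤m u = begin
      ∑[ i ∈ range j (m ∸ j) ] 𝟙 (nl ∧ does (crossing? u i))
        ≡⟨ ∑-cong (range j (m ∸ j)) (λ {i} _ → 𝟙-∧ nl (does (crossing? u i))) ⟩
      ∑[ i ∈ range j (m ∸ j) ] 𝟙 nl * 𝟙 (does (crossing? u i))
        ≡⟨ ∑-*ˡ (range j (m ∸ j)) (𝟙 nl) _ ⟩
      𝟙 nl * (∑[ i ∈ range j (m ∸ j) ] 𝟙 (does (crossing? u i)))
        ≤⟨ 𝟙-guard (nonLeaf? u) (λ nonleaf → crossings≤feasible nonleaf j≤m) ⟩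
      𝟙 nl * linkSum E Tr (λ a b → 𝟙 (does (Comp.crosses? j u a b)) * x a b)
        ≡⟨ sym (linkSum-*ˡ E Tr (𝟙 nl) _) ⟩
      linkSum E Tr (λ a b → 𝟙 nl * (𝟙 (does (Comp.crosses? j u a b)) * x a b))
        ≡⟨ linkSum-cong E Tr (λ a b _ → trans (sym (ℚ.*-assoc (𝟙 nl) _ (x a b)))
                                              (cong (_* x a b) (sym (𝟙-∧ nl _)))) ⟩
      linkSum E Tr (λ a b → 𝟙 (nl ∧ does (Comp.crosses? j u a b)) * x a b) ∎
      where
      open ℚ.≤-Reasoning
      nl : Bool
      nl = does (nonLeaf? u)

    covering : ∀ j → j ℕ.< m → ∑[ i ∈ range j (m ∸ j) ] ℕtoℚ (A i (ℓ i)) ≤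
                               linkSum E Tr (λ a b → x a b * ℕtoℚ (A j (a , b)))
    covering j j<m = begin
      ∑[ i ∈ range j (m ∸ j) ] ℕtoℚ (A i (ℓ i))
        ≡⟨ ∑-cong (range j (m ∸ j)) (λ {i} _ → sym (∑-𝟙 (inc? i (ℓ i)) (allFin n))) ⟩
      ∑[ i ∈ range j (m ∸ j) ] ∑[ u ∈ allFin n ] 𝟙 (does (inc? i (ℓ i) u))
        ≡⟨ ∑-swap (range j (m ∸ j)) (allFin n) (λ i u → 𝟙 (does (inc? i (ℓ i) u))) ⟩
      ∑[ u ∈ allFin n ] ∑[ i ∈ range j (m ∸ j) ] 𝟙 (does (inc? i (ℓ i) u))
        ≤⟨ ∑-mono (allFin n) (λ {u} _ → incidences≤feasible (ℕ.<⇒≤ j<m) u) ⟩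
      ∑[ u ∈ allFin n ] linkSum E Tr (λ a b → 𝟙 (does (inc? j (a , b) u)) * x a b)
        ≡⟨ ∑-linkSum E Tr (allFin n) _ ⟩
      linkSum E Tr (λ a b → ∑[ u ∈ allFin n ] 𝟙 (does (inc? j (a , b) u)) * x a b)
        ≡⟨ linkSum-cong E Tr (λ a b _ → begin-equality
             ∑[ u ∈ allFin n ] 𝟙 (does (inc? j (a , b) u)) * x a b
               ≡⟨ ∑-cong (allFin n) (λ {u} _ → ℚ.*-comm _ (x a b)) ⟩
             ∑[ u ∈ allFin n ] x a b * 𝟙 (does (inc? j (a , b) u))
               ≡⟨ ∑-*ˡ (allFin n) (x a b) _ ⟩
             x a b * (∑[ u ∈ allFin n ] 𝟙 (does (inc? j (a , b) u)))
               ≡⟨ cong (x a b *_) (∑-𝟙 (inc? j (a , b)) (allFin n)) ⟩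
             x a b * ℕtoℚ (A j (a , b)) ∎) ⟩
      linkSum E Tr (λ a b → x a b * ℕtoℚ (A j (a , b))) ∎
      where open ℚ.≤-Reasoning

  module _ (run : GreedyRun E Tr c Fs) where

    greedy-choice : ∀ {j} → j ℕ.< m → GreedyChoice E Tr c (take j Fs) (ℓ j)
    greedy-choice {j} j<m =
      subst₂ (λ i e → GreedyChoice E Tr c (take i Fs) e) (Fin.toℕ-fromℕ< j<m)
             (trans (lookup≡nth ℓ₀ Fs i) (cong ℓ (Fin.toℕ-fromℕ< j<m))) (proj₂ (proj₁ run i))
      where
      i : Fin m
      i = fromℕ< j<m

    ℓ-link : ∀ j → j ℕ.< m → isLink E Tr (proj₁ (ℓ j)) (proj₂ (ℓ j)) ≡ true
    ℓ-link j j<m = proj₁ (greedy-choice j<m)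

    k-pos : ∀ j → j ℕ.< m → 0 ℕ.< A j (ℓ j)
    k-pos j j<m = positive (greedy-choice j<m)
      where
      positive : GreedyChoice E Tr c (take j Fs) (ℓ j) → 0 ℕ.< A j (ℓ j)
      positive (_ , k , card , k>0 , _) =
        subst (0 ℕ.<_) (Card-unique card (Card-count (inc? j (ℓ j)))) k>0

    greedy : ∀ j → j ℕ.< m → ∀ a b → isLink E Tr a b ≡ true → 0 ℕ.< A j (a , b) →
             lcost c (ℓ j) * ℕtoℚ (A j (a , b)) ≤ c a b * ℕtoℚ (A j (ℓ j))
    greedy j j<m a b link A>0 = best-ratio (greedy-choice j<m)
      where
      best-ratio : GreedyChoice E Tr c (take j Fs) (ℓ j) →
                   lcost c (ℓ j) * ℕtoℚ (A j (a , b)) ≤ c a b * ℕtoℚ (A j (ℓ j))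
      best-ratio (_ , k , card , _ , best) =
        subst (λ k′ → lcost c (ℓ j) * ℕtoℚ (A j (a , b)) ≤ c a b * ℕtoℚ k′)
              (Card-unique card (Card-count (inc? j (ℓ j))))
              (best a b (A j (a , b)) link (Card-count (inc? j (a , b))) A>0)

    greedy-run-bound : (∀ i → E i i ≡ false) → Connected (Adj Tr) →
                       (∀ i j → E i j ≡ true → 0ℚ ≤ c i j) → ∀ {lam} →
                       (∀ a b k → isLink E Tr a b ≡ true → TreePathLength Tr a b k → k ℕ.≤ lam) →
                       ((u : Fin n) → ∃ (_≢ u)) → ∀ x → FeasibleP E Tr x →
                       costList c Fs ≤ H (lam ∸ 1) * linkSum E Tr (λ a b → c a b * x a b)
    greedy-run-bound loopless Tr-connected c-nonneg {lam} lam-max another x feasible =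
      subst (_≤ H (lam ∸ 1) * linkSum E Tr (λ a b → c a b * x a b)) (sym (costList≡∑ c ℓ₀ Fs))
        (greedy-cost-bound (λ a b link → c-nonneg a b (link⇒edge {E = E} {Tr} link)) (proj₁ feasible)
                           ℓ-link k-pos greedy A-antitone (A-final (proj₂ run))
                           (covering x feasible another) (lam ∸ 1) (A-initial loopless Tr-connected lam-max))
      where open GreedyAccounting E Tr c x m ℓ A

¬¬-∀-Fin : ∀ {n} {P : Fin n → Set} → (∀ i → ¬ ¬ P i) → ¬ ¬ (∀ i → P i)
¬¬-∀-Fin {zero}  h ¬∀ = ¬∀ λ ()
¬¬-∀-Fin {suc n} h ¬∀ =
  h zero λ p₀ → ¬¬-∀-Fin (h ∘ suc) λ p₊ → ¬∀ λ { zero → p₀ ; (suc i) → p₊ i }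

¬¬-∀-take : ∀ {A : Set} {Q : List A → Set} (xs : List A) →
            (∀ ys → ¬ ¬ Q ys) → ¬ ¬ (∀ i → Q (take i xs))
¬¬-∀-take []       h ¬∀ = h [] λ q → ¬∀ λ { zero → q ; (suc _) → q }
¬¬-∀-take (x ∷ xs) h ¬∀ =
  h [] λ q₀ → ¬¬-∀-take xs (h ∘ (x ∷_)) λ q₊ → ¬∀ λ { zero → q₀ ; (suc i) → q₊ i }

theorem3p4 : (n : ℕ) (E Tr : BRel n) (cost : Fin n → Fin n → ℚ)
    → SimpleGraph E
    → TwoNodeConnected n (Adj E)
    → SpanningTree E Tr
    → (∀ i j → E i j ≡ true → 0ℚ ≤ cost i j)
    → (∀ i j → Tr i j ≡ true → cost i j ≡ 0ℚ)
    → (lam : ℕ) → IsMaxTreePathLength E Tr lam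
    → (Fhat : List (Link n)) → GreedyRun E Tr cost Fhat
    → (x : Fin n → Fin n → ℚ) → FeasibleP E Tr x
    → costList cost Fhat ≤ H (lam ∸ 1) * linkSum E Tr (λ i j → cost i j * x i j)
theorem3p4 n E Tr cost (_ , loopless) (3≤n , _) (_ , Tr-sym , Tr-connected , _) cost-nonneg _
           lam (lam-max , _) Fhat run x feasible =
  decidable-stable (_ ℚ.≤? _) λ ¬bound →
    reachability-decidable λ reach? → nonLeaf-decidable λ nonLeaf? →
    ¬bound (GreedyRunAnalysis.greedy-run-bound E Tr cost Fhat Tr-sym reach? nonLeaf? (v₀ , v₀) run
              loopless Tr-connected cost-nonneg lam-max (another 2≤n) x feasible)
  where
  -- The goal is a decidable inequality, hence ¬¬-stable; this lets us assume that
  -- reachability and being a non-leaf are decidable.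
  reachability-decidable : ¬ ¬ (∀ s u a b → Dec (Reach (TF Tr (take s Fhat)) (_≢ u) a b))
  reachability-decidable = ¬¬-∀-take {Q = λ Fs → ∀ u a b → Dec (Reach (TF Tr Fs) (_≢ u) a b)} Fhat
    λ _ → ¬¬-∀-Fin λ _ → ¬¬-∀-Fin λ _ → ¬¬-∀-Fin λ _ → ¬¬-excluded-middle
  nonLeaf-decidable : ¬ ¬ (∀ u → Dec (NonLeaf Tr u))
  nonLeaf-decidable = ¬¬-∀-Fin λ _ → ¬¬-excluded-middle
  2≤n : 2 ℕ.≤ n
  2≤n = ℕ.≤-trans (ℕ.n≤1+n 2) 3≤n
  v₀ : Fin n
  v₀ = fromℕ< (ℕ.≤-trans (s≤s z≤n) 3≤n)
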